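{- Let $1 \le t \le k < n$ be integers, and let $x_1, \dots, x_n$ be real numbers of which exactly $t$ are nonnegative. Suppose that for every subset $U \subseteq \{1,\dots,n\}$ with $|U| > k$ we have $\sum_{i\in U} x_i < 0$. Then the number of subsets $U \subseteq \{1,\dots,n\}$ (including the empty set) with $\sum_{i \in U} x_i \ge 0$ is at most $$2^{t-1}\left(\binom{n-t}{k-t} + \binom{n-t}{k-t-1} + \cdots + \binom{n-t}{0} + 1\right).$$ Moreover, this bound is tight: for all integers $1 \le t \le k < n$ there exist real numbers $x_1,\dots,x_n$, exactly $t$ of them nonnegative, satisfying the hypothesis and having exactly this many subsets with nonnegative sum.
   Context: Subsets of the sequence are identified with subsets of the index set $\{1,\dots,n\}$; the empty set has sum $0$ and so counts as a subset with nonnegative sum.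
   Formalization: The numbers $x_1, \dots, x_n$ are taken in ℚ rather than in the reals, both in the upper bound and in the tightness example. -}

module Defs where

open import Data.Bool using (Bool; true; false; if_then_else_)
open import Data.Nat using (ℕ; zero; suc; _∸_; _^_) renaming (_+_ to _+ℕ_; _*_ to _*ℕ_)
open import Data.Nat.Combinatorics using (_C_)
open import Data.Fin using (Fin; zero; suc)
open import Data.Fin.Subset using (Subset)
open import Data.Vec using (Vec; []; _∷_; tabulate)
open import Data.List using (List; []; _∷_; _++_; map; filter; length; upTo)
open import Data.Nat.ListAction using (sum)
open import Data.Rational using (ℚ; 0ℚ; _+_; _≤?_)
open import Relation.Nullary using (does)

subsetSum : ∀ {n} → (Fin n → ℚ) → Subset n → ℚ
subsetSum {zero}  x []      = 0ℚ
subsetSum {suc n} x (b ∷ U) = (if b then x zero else 0ℚ) + subsetSum (λ i → x (suc i)) U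

allSubsets : (n : ℕ) → List (Subset n)
allSubsets zero    = [] ∷ []
allSubsets (suc n) = map (true ∷_) (allSubsets n) ++ map (false ∷_) (allSubsets n)

nonnegIndices : ∀ {n} → (Fin n → ℚ) → Subset n
nonnegIndices x = tabulate (λ i → does (0ℚ ≤? x i))

numNonnegSubsets : ∀ {n} → (Fin n → ℚ) → ℕ
numNonnegSubsets {n} x = length (filter (λ U → 0ℚ ≤? subsetSum x U) (allSubsets n))

bound : ℕ → ℕ → ℕ → ℕ
bound n k t = 2 ^ (t ∸ 1) *ℕ (sum (map (λ j → (n ∸ t) C j) (upTo (suc (k ∸ t)))) +ℕ 1)

{-# OPTIONS --safe #-}
-- Let N(c) be the number of sets of positions of the sequence on which c + Σ is nonnegative;
-- it does not depend on the order, so the t nonnegative entries can be put first. The core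
-- is a bound for pairs of offsets: if c₁, c₂ ≥ 0 and no set of more than k positions has
-- c₁ + c₂ + Σ ≥ 0, then N(c₁) + N(c₂) ≤ 2^t (Σ_{j ≤ k-t} C(n-t, j) + 1). A nonnegative
-- entry p doubles the bound: splitting both counts by whether a set contains p and
-- regrouping them as N(c₁ + p) + N(c₂) and N(c₁) + N(c₂ + p) preserves the hypothesis,
-- which only involves the sum c₁ + c₂ + p. Over the nonpositive entries one inducts on their
-- number and on k - t, according to the signs of c₁ + y and c₂ + y for the first entry y.
-- Taking c₁ = c₂ = 0 bounds twice the number of nonnegative subsets. The bound is attained
-- by (k - t, 0, …, 0, -1, …, -1).
module Submission where

open import Defs
open import Algebra.Bundles using (CommutativeMonoid)
import Algebra.Properties.CommutativeSemigroup as CommutativeSemigroupProperties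
open import Data.Bool using (true; false)
open import Data.Fin using (Fin; zero; suc)
open import Data.Fin.Subset using (Subset; ∣_∣)
open import Data.List
  using (List; []; _∷_; [_]; _++_; length; filter; map; replicate; tabulate; lookup; upTo)
open import Data.List.Properties
  using ( length-++; length-replicate; length-tabulate; tabulate-lookup; map-++; upTo-∷ʳ
        ; filter-++; filter-≐; filter-accept; filter-reject; filter-all; filter-none)
import Data.List.Relation.Unary.All as All
open All using (All; []; _∷_)
open import Data.List.Relation.Unary.All.Properties using (all-filter; replicate⁺)
import Data.List.Relation.Binary.Permutation.Propositional as ↭
open ↭ using (_↭_; prep; swap)
open import Data.List.Relation.Binary.Permutation.Propositional.Properties
  using (shift; ↭-length)
open import Data.Nat using (ℕ; zero; suc; pred; _+_; _*_; _^_; _∸_; _≤_; _<_; z≤n; s≤s)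
import Data.Nat.Properties as ℕ
open import Data.Nat.Combinatorics using (_C_; nCk+nC[k+1]≡[n+1]C[k+1]; nCn≡1; k>n⇒nCk≡0)
open import Data.Nat.ListAction using (sum)
open import Data.Nat.ListAction.Properties using (sum-++)
open import Data.Product using (_×_; _,_; Σ; proj₁; proj₂)
open import Data.Rational using (ℚ; 0ℚ; 1ℚ; -_; _≤?_)
  renaming (_+_ to _+ℚ_; _≤_ to _≤ℚ_; _<_ to _<ℚ_)
import Data.Rational.Properties as ℚ
open import Data.Sum using (inj₁; inj₂)
import Data.Vec as Vec
open Vec using ([]; _∷_)
open import Function using (_∘_)
open import Level using (Level)
open import Relation.Nullary using (Dec; yes; no; does; ¬_; contradiction)
open import Relation.Unary using (Pred; Decidable)
open import Relation.Unary.Properties using (∁?)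
open import Relation.Binary.PropositionalEquality
  using (_≡_; refl; sym; trans; cong; cong₂; subst; module ≡-Reasoning)

module ℕ+ = CommutativeSemigroupProperties ℕ.+-commutativeSemigroup
module ℚ+ = CommutativeSemigroupProperties
  (CommutativeMonoid.commutativeSemigroup ℚ.+-0-commutativeMonoid)

private
  variable
    a b p : Level

[m+n]+[o+p]≡[m+p]+[n+o] : ∀ m n o p → (m + n) + (o + p) ≡ (m + p) + (n + o)
[m+n]+[o+p]≡[m+p]+[n+o] m n o p =
  trans (cong ((m + n) +_) (ℕ.+-comm o p)) (ℕ+.interchange m n p o)

pred[m]≤n⇒m≤1+n : ∀ {m n} → pred m ≤ n → m ≤ suc n
pred[m]≤n⇒m≤1+n {zero}  _   = z≤n
pred[m]≤n⇒m≤1+n {suc _} m≤n = s≤s m≤n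

≤⇒≯ : ∀ {p q} → p ≤ℚ q → ¬ (q <ℚ p)
≤⇒≯ p≤q q<p = ℚ.<-irrefl refl (ℚ.≤-<-trans p≤q q<p)

p≤p+q : ∀ {p q} → 0ℚ ≤ℚ q → p ≤ℚ p +ℚ q
p≤p+q {p} 0≤q = ℚ.≤-trans (ℚ.≤-reflexive (sym (ℚ.+-identityʳ p))) (ℚ.+-monoʳ-≤ p 0≤q)

p≤q+p : ∀ {p q} → 0ℚ ≤ℚ q → p ≤ℚ q +ℚ p
p≤q+p {p} {q} 0≤q = subst (p ≤ℚ_) (ℚ.+-comm p q) (p≤p+q 0≤q)

0≤p+q : ∀ {p q} → 0ℚ ≤ℚ p → 0ℚ ≤ℚ q → 0ℚ ≤ℚ p +ℚ q
0≤p+q 0≤p 0≤q = ℚ.≤-trans 0≤p (p≤p+q 0≤q)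

-- Partial sums of binomial coefficients

binomialSum : ℕ → ℕ → ℕ
binomialSum m zero    = 1
binomialSum m (suc r) = binomialSum m r + m C suc r

sum-binomials≡binomialSum : ∀ m r → sum (map (m C_) (upTo (suc r))) ≡ binomialSum m r
sum-binomials≡binomialSum m zero    = refl
sum-binomials≡binomialSum m (suc r) = begin
  sum (map (m C_) (upTo (suc (suc r))))             ≡⟨ cong (sum ∘ map (m C_)) (upTo-∷ʳ (suc r)) ⟨
  sum (map (m C_) (upTo (suc r) ++ [ suc r ]))      ≡⟨ cong sum (map-++ (m C_) (upTo (suc r)) _) ⟩
  sum (map (m C_) (upTo (suc r)) ++ [ m C suc r ])  ≡⟨ sum-++ (map (m C_) (upTo (suc r))) _ ⟩
  sum (map (m C_) (upTo (suc r))) + (m C suc r + 0)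
    ≡⟨ cong₂ _+_ (sum-binomials≡binomialSum m r) (ℕ.+-identityʳ _) ⟩
  binomialSum m r + m C suc r                       ∎
  where open ≡-Reasoning

binomialSum-pascal : ∀ m r →
                     binomialSum (suc m) (suc r) ≡ binomialSum m r + binomialSum m (suc r)
binomialSum-pascal m zero    = cong (1 +_) (sym (nCk+nC[k+1]≡[n+1]C[k+1] m 0))
binomialSum-pascal m (suc r) = begin
  binomialSum (suc m) (suc r) + suc m C suc (suc r)
    ≡⟨ cong₂ _+_ (binomialSum-pascal m r) (sym (nCk+nC[k+1]≡[n+1]C[k+1] m (suc r))) ⟩
  (binomialSum m r + binomialSum m (suc r)) + (m C suc r + m C suc (suc r))
    ≡⟨ ℕ+.interchange (binomialSum m r) _ _ _ ⟩
  binomialSum m (suc r) + binomialSum m (suc (suc r))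
    ∎
  where open ≡-Reasoning

binomialSum-0 : ∀ r → binomialSum 0 r ≡ 1
binomialSum-0 zero    = refl
binomialSum-0 (suc r) = cong₂ _+_ (binomialSum-0 r) (k>n⇒nCk≡0 {k = suc r} (s≤s z≤n))

binomialSum[m,m]≡2^m : ∀ m → binomialSum m m ≡ 2 ^ m
binomialSum[m,m]≡2^m zero    = refl
binomialSum[m,m]≡2^m (suc m) = begin
  binomialSum (suc m) (suc m)                     ≡⟨ binomialSum-pascal m m ⟩
  binomialSum m m + (binomialSum m m + m C suc m)
    ≡⟨ cong (λ c → binomialSum m m + (binomialSum m m + c)) (k>n⇒nCk≡0 (ℕ.n<1+n m)) ⟩
  binomialSum m m + (binomialSum m m + 0)
    ≡⟨ cong (λ s → s + (s + 0)) (binomialSum[m,m]≡2^m m) ⟩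
  2 ^ suc m                                       ∎
  where open ≡-Reasoning

binomialSum[1+m,m]+1≡2^[1+m] : ∀ m → binomialSum (suc m) m + 1 ≡ 2 ^ suc m
binomialSum[1+m,m]+1≡2^[1+m] m =
  trans (cong (binomialSum (suc m) m +_) (sym (nCn≡1 (suc m)))) (binomialSum[m,m]≡2^m (suc m))

0<nCk : ∀ {n k} → k ≤ n → 0 < n C k
0<nCk {n}     {zero}  _         = s≤s z≤n
0<nCk {suc n} {suc k} (s≤s k≤n) =
  subst (0 <_) (nCk+nC[k+1]≡[n+1]C[k+1] n k) (ℕ.<-≤-trans (0<nCk k≤n) (ℕ.m≤m+n _ _))

binomialSum-step : ∀ {m r} → r < m → binomialSum m r + 1 ≤ binomialSum m (suc r)
binomialSum-step {m} {r} r<m = ℕ.+-monoʳ-≤ (binomialSum m r) (0<nCk r<m)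

-- #nonneg c j xs is the number of sets U of positions of xs with |U| ≥ j and
-- c + Σ_{i∈U} xs_i ≥ 0.
#nonneg : ℚ → ℕ → List ℚ → ℕ
#nonneg c j       (x ∷ xs) = #nonneg (c +ℚ x) (pred j) xs + #nonneg c j xs
#nonneg c zero    []       with 0ℚ ≤? c
... | yes _ = 1
... | no  _ = 0
#nonneg c (suc j) []       = 0

#nonneg[]-nonneg : ∀ {c} → 0ℚ ≤ℚ c → #nonneg c 0 [] ≡ 1
#nonneg[]-nonneg {c} 0≤c with 0ℚ ≤? c
... | yes _   = refl
... | no 0≰c = contradiction 0≤c 0≰c

#nonneg[]-neg : ∀ {c} j → c <ℚ 0ℚ → #nonneg c j [] ≡ 0
#nonneg[]-neg {c} zero c<0 with 0ℚ ≤? c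
... | yes 0≤c = contradiction c<0 (≤⇒≯ 0≤c)
... | no _    = refl
#nonneg[]-neg (suc j) _ = refl

#nonneg[]≡0⇒neg : ∀ {c} → #nonneg c 0 [] ≡ 0 → c <ℚ 0ℚ
#nonneg[]≡0⇒neg {c} none with 0ℚ ≤? c
... | no 0≰c = ℚ.≰⇒> 0≰c

#nonneg[]≤1 : ∀ c → #nonneg c 0 [] ≤ 1
#nonneg[]≤1 c with 0ℚ ≤? c
... | yes _ = ℕ.≤-refl
... | no _  = z≤n

#nonneg-↭ : ∀ {xs ys} → xs ↭ ys → ∀ c j → #nonneg c j xs ≡ #nonneg c j ys
#nonneg-↭ ↭.refl         c j = refl
#nonneg-↭ (prep x xs↭ys) c j =
  cong₂ _+_ (#nonneg-↭ xs↭ys (c +ℚ x) (pred j)) (#nonneg-↭ xs↭ys c j)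
#nonneg-↭ (↭.trans p q)  c j = trans (#nonneg-↭ p c j) (#nonneg-↭ q c j)
#nonneg-↭ (swap {xs} {ys} x y xs↭ys) c j = begin
  (N (c +ℚ x +ℚ y) j″ xs + N (c +ℚ x) j′ xs) + (N (c +ℚ y) j′ xs + N c j xs)
    ≡⟨ ℕ+.interchange (N (c +ℚ x +ℚ y) j″ xs) _ _ _ ⟩
  (N (c +ℚ x +ℚ y) j″ xs + N (c +ℚ y) j′ xs) + (N (c +ℚ x) j′ xs + N c j xs)
    ≡⟨ cong₂ _+_
         (cong₂ _+_ (trans (cong (λ d → N d j″ xs) (ℚ+.xy∙z≈xz∙y c x y)) (#nonneg-↭ xs↭ys _ j″))
                    (#nonneg-↭ xs↭ys _ j′))
         (cong₂ _+_ (#nonneg-↭ xs↭ys _ j′) (#nonneg-↭ xs↭ys c j)) ⟩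
  (N (c +ℚ y +ℚ x) j″ ys + N (c +ℚ y) j′ ys) + (N (c +ℚ x) j′ ys + N c j ys)
    ∎
  where
  open ≡-Reasoning
  N = #nonneg
  j′ = pred j
  j″ = pred j′

#nonneg-mono : ∀ {c c′} j xs → c ≤ℚ c′ → #nonneg c j xs ≤ #nonneg c′ j xs
#nonneg-mono j (x ∷ xs) c≤c′ =
  ℕ.+-mono-≤ (#nonneg-mono (pred j) xs (ℚ.+-monoˡ-≤ x c≤c′)) (#nonneg-mono j xs c≤c′)
#nonneg-mono {c} zero [] c≤c′ with 0ℚ ≤? c
... | yes 0≤c = ℕ.≤-reflexive (sym (#nonneg[]-nonneg (ℚ.≤-trans 0≤c c≤c′)))
... | no _    = z≤n
#nonneg-mono (suc j) [] _ = z≤n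

#nonneg≡0-mono : ∀ {c c′} j xs → c ≤ℚ c′ → #nonneg c′ j xs ≡ 0 → #nonneg c j xs ≡ 0
#nonneg≡0-mono j xs c≤c′ none =
  ℕ.n≤0⇒n≡0 (ℕ.≤-trans (#nonneg-mono j xs c≤c′) (ℕ.≤-reflexive none))

#nonneg-antitone : ∀ c {i j} xs → i ≤ j → #nonneg c j xs ≤ #nonneg c i xs
#nonneg-antitone c (x ∷ xs) i≤j =
  ℕ.+-mono-≤ (#nonneg-antitone (c +ℚ x) xs (ℕ.pred-mono-≤ i≤j)) (#nonneg-antitone c xs i≤j)
#nonneg-antitone c {j = zero}  [] z≤n = ℕ.≤-refl
#nonneg-antitone c {j = suc _} [] _   = z≤n

#nonneg-nonpositive : ∀ {c} j xs → c <ℚ 0ℚ → All (_≤ℚ 0ℚ) xs → #nonneg c j xs ≡ 0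
#nonneg-nonpositive j []       c<0 []          = #nonneg[]-neg j c<0
#nonneg-nonpositive j (x ∷ xs) c<0 (x≤0 ∷ xs≤0) =
  cong₂ _+_ (#nonneg-nonpositive (pred j) xs (ℚ.+-mono-<-≤ c<0 x≤0) xs≤0)
            (#nonneg-nonpositive j xs c<0 xs≤0)

#nonneg-≤-binomialSum : ∀ c r xs → #nonneg c (suc r) xs ≡ 0 →
                        #nonneg c 0 xs ≤ binomialSum (length xs) r
#nonneg-≤-binomialSum c r [] _ =
  ℕ.≤-trans (#nonneg[]≤1 c) (ℕ.≤-reflexive (sym (binomialSum-0 r)))
#nonneg-≤-binomialSum c zero (x ∷ xs) none =
  ℕ.+-mono-≤ (ℕ.≤-reflexive (ℕ.m+n≡0⇒m≡0 _ none))
             (#nonneg-≤-binomialSum c zero xs (ℕ.m+n≡0⇒n≡0 _ none))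
#nonneg-≤-binomialSum c (suc r) (x ∷ xs) none = begin
  #nonneg (c +ℚ x) 0 xs + #nonneg c 0 xs
    ≤⟨ ℕ.+-mono-≤ (#nonneg-≤-binomialSum (c +ℚ x) r xs (ℕ.m+n≡0⇒m≡0 _ none))
                  (#nonneg-≤-binomialSum c (suc r) xs (ℕ.m+n≡0⇒n≡0 _ none)) ⟩
  binomialSum (length xs) r + binomialSum (length xs) (suc r)
    ≡⟨ binomialSum-pascal (length xs) r ⟨
  binomialSum (suc (length xs)) (suc r)
    ∎
  where open ℕ.≤-Reasoning

-- Pairs U with its complement: c₁ + Σ_U ≥ 0 and c₂ + Σ_{∁U} ≥ 0 would force c₁ + c₂ + Σ xs ≥ 0.
#nonneg-pair-≤-2^ : ∀ c₁ c₂ xs → #nonneg (c₁ +ℚ c₂) (length xs) xs ≡ 0 →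
                    #nonneg c₁ 0 xs + #nonneg c₂ 0 xs ≤ 2 ^ length xs
#nonneg-pair-≤-2^ c₁ c₂ [] none with 0ℚ ≤? c₁ | 0ℚ ≤? c₂
... | yes 0≤c₁ | yes 0≤c₂ = contradiction (#nonneg[]≡0⇒neg none) (≤⇒≯ (0≤p+q 0≤c₁ 0≤c₂))
... | yes _    | no _     = ℕ.≤-refl
... | no _     | yes _    = ℕ.≤-refl
... | no _     | no _     = z≤n
#nonneg-pair-≤-2^ c₁ c₂ (x ∷ xs) none = begin
  (N (c₁ +ℚ x) + N c₁) + (N (c₂ +ℚ x) + N c₂) ≡⟨ [m+n]+[o+p]≡[m+p]+[n+o] (N (c₁ +ℚ x)) _ _ _ ⟩
  (N (c₁ +ℚ x) + N c₂) + (N c₁ + N (c₂ +ℚ x)) ≤⟨ ℕ.+-mono-≤ (#nonneg-pair-≤-2^ _ _ xs none₁)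
                                                             (#nonneg-pair-≤-2^ _ _ xs none₂) ⟩
  2 ^ length xs + 2 ^ length xs              ≡⟨ cong (2 ^ length xs +_) (ℕ.+-identityʳ _) ⟨
  2 ^ suc (length xs)                        ∎
  where
  open ℕ.≤-Reasoning
  N : ℚ → ℕ
  N c = #nonneg c 0 xs
  none′ : #nonneg ((c₁ +ℚ c₂) +ℚ x) (length xs) xs ≡ 0
  none′ = ℕ.m+n≡0⇒m≡0 _ none
  none₁ : #nonneg ((c₁ +ℚ x) +ℚ c₂) (length xs) xs ≡ 0
  none₁ = subst (λ c → #nonneg c (length xs) xs ≡ 0) (ℚ+.xy∙z≈xz∙y c₁ c₂ x) none′
  none₂ : #nonneg (c₁ +ℚ (c₂ +ℚ x)) (length xs) xs ≡ 0
  none₂ = subst (λ c → #nonneg c (length xs) xs ≡ 0) (ℚ.+-assoc c₁ c₂ x) none′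

PairBound : ℕ → List ℚ → Set
PairBound r ns = ∀ c₁ c₂ → 0ℚ ≤ℚ c₁ → 0ℚ ≤ℚ c₂ → #nonneg (c₁ +ℚ c₂) (suc r) ns ≡ 0 →
                 #nonneg c₁ 0 ns + #nonneg c₂ 0 ns ≤ binomialSum (length ns) r + 1

pairBound-0 : ∀ ns → PairBound 0 ns
pairBound-0 ns c₁ c₂ 0≤c₁ 0≤c₂ none = ℕ.+-mono-≤
  (#nonneg-≤-binomialSum c₁ 0 ns (#nonneg≡0-mono 1 ns (p≤p+q 0≤c₂) none))
  (#nonneg-≤-binomialSum c₂ 0 ns (#nonneg≡0-mono 1 ns (p≤q+p 0≤c₁) none))

pairBound-top : ∀ y ys → PairBound (length ys) (y ∷ ys)
pairBound-top y ys c₁ c₂ _ _ none = begin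
  #nonneg c₁ 0 (y ∷ ys) + #nonneg c₂ 0 (y ∷ ys) ≤⟨ #nonneg-pair-≤-2^ c₁ c₂ (y ∷ ys) none ⟩
  2 ^ suc (length ys)                           ≡⟨ binomialSum[1+m,m]+1≡2^[1+m] (length ys) ⟨
  binomialSum (suc (length ys)) (length ys) + 1 ∎
  where open ℕ.≤-Reasoning

pairBound-step-dead : ∀ r y ys → All (_≤ℚ 0ℚ) ys → PairBound (suc r) ys →
  ∀ c₁ c₂ → c₁ +ℚ y <ℚ 0ℚ → 0ℚ ≤ℚ c₁ → 0ℚ ≤ℚ c₂ →
  #nonneg (c₁ +ℚ c₂) (suc (suc r)) (y ∷ ys) ≡ 0 →
  #nonneg c₁ 0 (y ∷ ys) + #nonneg c₂ 0 (y ∷ ys) ≤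
  binomialSum (length ys) r + (binomialSum (length ys) (suc r) + 1)
pairBound-step-dead r y ys ys≤0 ih′ c₁ c₂ c₁+y<0 0≤c₁ 0≤c₂ none = begin
  (#nonneg (c₁ +ℚ y) 0 ys + B) + (E + D)
    ≡⟨ cong (λ a → (a + B) + (E + D)) (#nonneg-nonpositive 0 ys c₁+y<0 ys≤0) ⟩
  B + (E + D)           ≡⟨ ℕ+.x∙yz≈y∙xz B E D ⟩
  E + (B + D)           ≤⟨ ℕ.+-mono-≤ E≤ (ih′ c₁ c₂ 0≤c₁ 0≤c₂ (ℕ.m+n≡0⇒n≡0 _ none)) ⟩
  S r + (S (suc r) + 1) ∎
  where
  open ℕ.≤-Reasoning
  S = binomialSum (length ys)
  B = #nonneg c₁ 0 ys
  E = #nonneg (c₂ +ℚ y) 0 ys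
  D = #nonneg c₂ 0 ys
  E≤ : E ≤ S r
  E≤ = #nonneg-≤-binomialSum _ r ys
         (#nonneg≡0-mono (suc r) ys (ℚ.+-monoˡ-≤ y (p≤q+p {c₂} 0≤c₁)) (ℕ.m+n≡0⇒m≡0 _ none))

pairBound-step : ∀ r y ys → All (_≤ℚ 0ℚ) ys → suc r < length ys →
                 PairBound r ys → PairBound (suc r) ys → PairBound (suc r) (y ∷ ys)
pairBound-step r y ys ys≤0 1+r<m ih ih′ c₁ c₂ 0≤c₁ 0≤c₂ none = begin
  #nonneg c₁ 0 (y ∷ ys) + #nonneg c₂ 0 (y ∷ ys) ≤⟨ cases (0ℚ ≤? c₁ +ℚ y) (0ℚ ≤? c₂ +ℚ y) ⟩
  S r + (S (suc r) + 1)                         ≡⟨ ℕ.+-assoc (S r) _ 1 ⟨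
  (S r + S (suc r)) + 1                         ≡⟨ cong (_+ 1) (binomialSum-pascal (length ys) r) ⟨
  binomialSum (suc (length ys)) (suc r) + 1     ∎
  where
  open ℕ.≤-Reasoning
  S = binomialSum (length ys)
  dead = pairBound-step-dead r y ys ys≤0 ih′
  none₁ : ∀ {d} → (c₁ +ℚ c₂) +ℚ y ≡ d → #nonneg d (suc r) ys ≡ 0
  none₁ eq = subst (λ d → #nonneg d (suc r) ys ≡ 0) eq (ℕ.m+n≡0⇒m≡0 _ none)
  cases : Dec (0ℚ ≤ℚ c₁ +ℚ y) → Dec (0ℚ ≤ℚ c₂ +ℚ y) →
          #nonneg c₁ 0 (y ∷ ys) + #nonneg c₂ 0 (y ∷ ys) ≤ S r + (S (suc r) + 1)
  cases (no 0≰c₁+y) _           = dead c₁ c₂ (ℚ.≰⇒> 0≰c₁+y) 0≤c₁ 0≤c₂ none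
  cases (yes _)     (no 0≰c₂+y) =
    subst (_≤ S r + (S (suc r) + 1)) (ℕ.+-comm (#nonneg c₂ 0 (y ∷ ys)) _)
      (dead c₂ c₁ (ℚ.≰⇒> 0≰c₂+y) 0≤c₂ 0≤c₁
            (subst (λ c → #nonneg c (suc (suc r)) (y ∷ ys) ≡ 0) (ℚ.+-comm c₁ c₂) none))
  cases (yes 0≤c₁+y) (yes 0≤c₂+y) = begin
    (A + B) + (E + D)     ≡⟨ [m+n]+[o+p]≡[m+p]+[n+o] A B E D ⟩
    (A + D) + (B + E)     ≤⟨ ℕ.+-mono-≤
                               (ih (c₁ +ℚ y) c₂ 0≤c₁+y 0≤c₂ (none₁ (ℚ+.xy∙z≈xz∙y c₁ c₂ y)))
                               (ih c₁ (c₂ +ℚ y) 0≤c₁ 0≤c₂+y (none₁ (ℚ.+-assoc c₁ c₂ y))) ⟩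
    (S r + 1) + (S r + 1) ≤⟨ ℕ.+-monoʳ-≤ (S r + 1) (binomialSum-step (ℕ.<⇒≤ 1+r<m)) ⟩
    (S r + 1) + S (suc r) ≡⟨ ℕ.+-assoc (S r) 1 _ ⟩
    S r + (1 + S (suc r)) ≡⟨ cong (S r +_) (ℕ.+-comm 1 _) ⟩
    S r + (S (suc r) + 1) ∎
    where
    A = #nonneg (c₁ +ℚ y) 0 ys
    B = #nonneg c₁ 0 ys
    E = #nonneg (c₂ +ℚ y) 0 ys
    D = #nonneg c₂ 0 ys

pairBound : ∀ r ns → All (_≤ℚ 0ℚ) ns → r < length ns → PairBound r ns
pairBound zero    ns       _          _         = pairBound-0 ns
pairBound (suc r) (y ∷ ys) (_ ∷ ys≤0) (s≤s r<m) with ℕ.m≤n⇒m<n∨m≡n r<m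
... | inj₂ 1+r≡m = subst (λ j → PairBound j (y ∷ ys)) (sym 1+r≡m) (pairBound-top y ys)
... | inj₁ 1+r<m = pairBound-step r y ys ys≤0 1+r<m
  (pairBound r ys ys≤0 (ℕ.<-trans (ℕ.n<1+n r) 1+r<m)) (pairBound (suc r) ys ys≤0 1+r<m)

#nonneg-pair-≤ : ∀ r ps ns → All (0ℚ ≤ℚ_) ps → All (_≤ℚ 0ℚ) ns → r < length ns →
  ∀ c₁ c₂ → 0ℚ ≤ℚ c₁ → 0ℚ ≤ℚ c₂ → #nonneg (c₁ +ℚ c₂) (length ps + suc r) (ps ++ ns) ≡ 0 →
  #nonneg c₁ 0 (ps ++ ns) + #nonneg c₂ 0 (ps ++ ns) ≤
  2 ^ length ps * (binomialSum (length ns) r + 1)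
#nonneg-pair-≤ r [] ns [] ns≤0 r<m c₁ c₂ 0≤c₁ 0≤c₂ none =
  ℕ.≤-trans (pairBound r ns ns≤0 r<m c₁ c₂ 0≤c₁ 0≤c₂ none) (ℕ.≤-reflexive (sym (ℕ.*-identityˡ _)))
#nonneg-pair-≤ r (p ∷ ps) ns (0≤p ∷ ps≥0) ns≤0 r<m c₁ c₂ 0≤c₁ 0≤c₂ none = begin
  (N (c₁ +ℚ p) + N c₁) + (N (c₂ +ℚ p) + N c₂) ≡⟨ [m+n]+[o+p]≡[m+p]+[n+o] (N (c₁ +ℚ p)) _ _ _ ⟩
  (N (c₁ +ℚ p) + N c₂) + (N c₁ + N (c₂ +ℚ p))
    ≤⟨ ℕ.+-mono-≤ (IH (c₁ +ℚ p) c₂ (0≤p+q 0≤c₁ 0≤p) 0≤c₂ (ℚ+.xy∙z≈xz∙y c₁ c₂ p))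
                  (IH c₁ (c₂ +ℚ p) 0≤c₁ (0≤p+q 0≤c₂ 0≤p) (ℚ.+-assoc c₁ c₂ p)) ⟩
  X + X                                       ≡⟨ cong (X +_) (ℕ.+-identityʳ X) ⟨
  2 * X                                       ≡⟨ ℕ.*-assoc 2 (2 ^ length ps) _ ⟨
  2 ^ suc (length ps) * (binomialSum (length ns) r + 1) ∎
  where
  open ℕ.≤-Reasoning
  N : ℚ → ℕ
  N c = #nonneg c 0 (ps ++ ns)
  X = 2 ^ length ps * (binomialSum (length ns) r + 1)
  IH : ∀ d₁ d₂ → 0ℚ ≤ℚ d₁ → 0ℚ ≤ℚ d₂ → (c₁ +ℚ c₂) +ℚ p ≡ d₁ +ℚ d₂ → N d₁ + N d₂ ≤ X
  IH d₁ d₂ 0≤d₁ 0≤d₂ eq = #nonneg-pair-≤ r ps ns ps≥0 ns≤0 r<m d₁ d₂ 0≤d₁ 0≤d₂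
    (subst (λ d → #nonneg d (length ps + suc r) (ps ++ ns) ≡ 0) eq (ℕ.m+n≡0⇒m≡0 _ none))

↭-filter-++-filter-∁ : ∀ {A : Set a} {P : Pred A p} (P? : Decidable P) xs →
                       xs ↭ filter P? xs ++ filter (∁? P?) xs
↭-filter-++-filter-∁ P? []       = ↭.refl
↭-filter-++-filter-∁ P? (x ∷ xs) with P? x
... | yes _ = prep x (↭-filter-++-filter-∁ P? xs)
... | no  _ = ↭.trans (prep x (↭-filter-++-filter-∁ P? xs)) (↭.↭-sym (shift x _ _))

#nonneg-upperBound : ∀ t r xs → length (filter (0ℚ ≤?_) xs) ≡ suc t → r < length xs ∸ suc t →
                     #nonneg 0ℚ (suc (suc t + r)) xs ≡ 0 →
                     #nonneg 0ℚ 0 xs ≤ 2 ^ t * (binomialSum (length xs ∸ suc t) r + 1)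
#nonneg-upperBound t r xs #ps≡1+t r<n∸1+t none = ℕ.*-cancelˡ-≤ 2 (begin
  h + (h + 0)     ≡⟨ cong (h +_) (ℕ.+-identityʳ h) ⟩
  h + h           ≡⟨ cong₂ _+_ h≡h′ h≡h′ ⟩
  h′ + h′
    ≤⟨ #nonneg-pair-≤ r ps ns (all-filter _ xs) ns≤0 r<#ns 0ℚ 0ℚ ℚ.≤-refl ℚ.≤-refl none′ ⟩
  2 ^ length ps * (binomialSum (length ns) r + 1)
    ≡⟨ cong₂ (λ l m → 2 ^ l * (binomialSum m r + 1)) #ps≡1+t #ns≡ ⟩
  2 ^ suc t * Y   ≡⟨ ℕ.*-assoc 2 (2 ^ t) Y ⟩
  2 * (2 ^ t * Y) ∎)
  where
  open ℕ.≤-Reasoning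
  ps = filter (0ℚ ≤?_) xs
  ns = filter (∁? (0ℚ ≤?_)) xs
  h = #nonneg 0ℚ 0 xs
  h′ = #nonneg 0ℚ 0 (ps ++ ns)
  Y = binomialSum (length xs ∸ suc t) r + 1
  xs↭ps++ns : xs ↭ ps ++ ns
  xs↭ps++ns = ↭-filter-++-filter-∁ (0ℚ ≤?_) xs
  h≡h′ : h ≡ h′
  h≡h′ = #nonneg-↭ xs↭ps++ns 0ℚ 0
  ns≤0 : All (_≤ℚ 0ℚ) ns
  ns≤0 = All.map (ℚ.<⇒≤ ∘ ℚ.≰⇒>) (all-filter (∁? (0ℚ ≤?_)) xs)
  #ns≡ : length ns ≡ length xs ∸ suc t
  #ns≡ = begin-equality
    length ns                         ≡⟨ ℕ.m+n∸m≡n (length ps) (length ns) ⟨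
    length ps + length ns ∸ length ps
      ≡⟨ cong₂ _∸_ (trans (sym (length-++ ps)) (sym (↭-length xs↭ps++ns))) #ps≡1+t ⟩
    length xs ∸ suc t                 ∎
  r<#ns : r < length ns
  r<#ns = subst (r <_) (sym #ns≡) r<n∸1+t
  none′ : #nonneg (0ℚ +ℚ 0ℚ) (length ps + suc r) (ps ++ ns) ≡ 0
  none′ = subst (λ j → #nonneg 0ℚ j (ps ++ ns) ≡ 0)
                (sym (trans (cong (_+ suc r) #ps≡1+t) (ℕ.+-suc (suc t) r)))
                (trans (sym (#nonneg-↭ xs↭ps++ns 0ℚ _)) none)

-- Defined by recursion so that fromℕ (suc i) - 1 ≡ fromℕ i needs only the group laws.
fromℕ : ℕ → ℚ
fromℕ zero    = 0ℚ
fromℕ (suc i) = 1ℚ +ℚ fromℕ i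

0≤fromℕ : ∀ i → 0ℚ ≤ℚ fromℕ i
0≤fromℕ zero    = ℚ.≤-refl
0≤fromℕ (suc i) = 0≤p+q (ℚ.nonNegative⁻¹ 1ℚ) (0≤fromℕ i)

fromℕ[1+i]-1≡fromℕ[i] : ∀ i → fromℕ (suc i) +ℚ - 1ℚ ≡ fromℕ i
fromℕ[1+i]-1≡fromℕ[i] i =
  trans (ℚ+.xy∙z≈xz∙y 1ℚ (fromℕ i) (- 1ℚ)) (ℚ.+-identityˡ (fromℕ i))

-1<0 : - 1ℚ <ℚ 0ℚ
-1<0 = ℚ.negative⁻¹ (- 1ℚ)

minusOnes≤0 : ∀ m → All (_≤ℚ 0ℚ) (replicate m (- 1ℚ))
minusOnes≤0 m = replicate⁺ m (ℚ.<⇒≤ -1<0)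

#nonneg-0∷ : ∀ c j xs → #nonneg c j (0ℚ ∷ xs) ≡ #nonneg c (pred j) xs + #nonneg c j xs
#nonneg-0∷ c j xs = cong (λ d → #nonneg d (pred j) xs + #nonneg c j xs) (ℚ.+-identityʳ c)

#nonneg-zeros++ : ∀ t c ys → #nonneg c 0 (replicate t 0ℚ ++ ys) ≡ 2 ^ t * #nonneg c 0 ys
#nonneg-zeros++ zero    c ys = sym (ℕ.*-identityˡ _)
#nonneg-zeros++ (suc t) c ys = begin
  #nonneg c 0 (0ℚ ∷ zs)              ≡⟨ #nonneg-0∷ c 0 zs ⟩
  #nonneg c 0 zs + #nonneg c 0 zs    ≡⟨ cong (λ n → n + n) (#nonneg-zeros++ t c ys) ⟩
  X + X                              ≡⟨ cong (X +_) (ℕ.+-identityʳ X) ⟨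
  2 * X                              ≡⟨ ℕ.*-assoc 2 (2 ^ t) _ ⟨
  2 ^ suc t * #nonneg c 0 ys         ∎
  where
  open ≡-Reasoning
  zs = replicate t 0ℚ ++ ys
  X = 2 ^ t * #nonneg c 0 ys

#nonneg-zeros++-vanish : ∀ t c {i j} ys → t + j ≤ i → #nonneg c j ys ≡ 0 →
                         #nonneg c i (replicate t 0ℚ ++ ys) ≡ 0
#nonneg-zeros++-vanish zero    c     ys j≤i none =
  ℕ.n≤0⇒n≡0 (ℕ.≤-trans (#nonneg-antitone c ys j≤i) (ℕ.≤-reflexive none))
#nonneg-zeros++-vanish (suc t) c {i} ys t+j<i none =
  trans (#nonneg-0∷ c i (replicate t 0ℚ ++ ys))
        (cong₂ _+_ (#nonneg-zeros++-vanish t c ys (ℕ.pred-mono-≤ t+j<i) none)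
                   (#nonneg-zeros++-vanish t c ys (ℕ.<⇒≤ t+j<i) none))

#nonneg-minusOnes : ∀ m i → #nonneg (fromℕ i) 0 (replicate m (- 1ℚ)) ≡ binomialSum m i
#nonneg-minusOnes zero    i       = trans (#nonneg[]-nonneg (0≤fromℕ i)) (sym (binomialSum-0 i))
#nonneg-minusOnes (suc m) zero    =
  cong₂ _+_ (#nonneg-nonpositive 0 _ (ℚ.negative⁻¹ _) (minusOnes≤0 m)) (#nonneg-minusOnes m 0)
#nonneg-minusOnes (suc m) (suc i) = begin
  #nonneg (fromℕ (suc i) +ℚ - 1ℚ) 0 minusOnes + #nonneg (fromℕ (suc i)) 0 minusOnes
    ≡⟨ cong₂ _+_ (trans (cong (λ c → #nonneg c 0 minusOnes) (fromℕ[1+i]-1≡fromℕ[i] i))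
                        (#nonneg-minusOnes m i))
                 (#nonneg-minusOnes m (suc i)) ⟩
  binomialSum m i + binomialSum m (suc i) ≡⟨ binomialSum-pascal m i ⟨
  binomialSum (suc m) (suc i)             ∎
  where
  open ≡-Reasoning
  minusOnes = replicate m (- 1ℚ)

#nonneg-minusOnes-vanish : ∀ m {i j} → i < j → #nonneg (fromℕ i) j (replicate m (- 1ℚ)) ≡ 0
#nonneg-minusOnes-vanish zero    (s≤s _) = refl
#nonneg-minusOnes-vanish (suc m) {zero} {j} i<j =
  cong₂ _+_ (#nonneg-nonpositive (pred j) _ (ℚ.negative⁻¹ _) (minusOnes≤0 m))
            (#nonneg-minusOnes-vanish m i<j)
#nonneg-minusOnes-vanish (suc m) {suc i} {suc j} (s≤s i<j) = cong₂ _+_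
  (trans (cong (λ c → #nonneg c j (replicate m (- 1ℚ))) (fromℕ[1+i]-1≡fromℕ[i] i))
         (#nonneg-minusOnes-vanish m i<j))
  (#nonneg-minusOnes-vanish m (s≤s i<j))

-- The extremal sequence (k - t, 0, …, 0, -1, …, -1) with t - 1 zeros and n - t entries -1,
-- written with t, m, r standing for the paper's t - 1, n - t, k - t.
extremal : ℕ → ℕ → ℕ → List ℚ
extremal t m r = fromℕ r ∷ replicate t 0ℚ ++ replicate m (- 1ℚ)

length-extremal : ∀ t m r → length (extremal t m r) ≡ suc t + m
length-extremal t m r = cong suc
  (trans (length-++ (replicate t 0ℚ)) (cong₂ _+_ (length-replicate t) (length-replicate m)))

#nonnegEntries-extremal : ∀ t m r → length (filter (0ℚ ≤?_) (extremal t m r)) ≡ suc t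
#nonnegEntries-extremal t m r = begin
  length (filter P? (extremal t m r))
    ≡⟨ cong length (filter-accept P? (0≤fromℕ r)) ⟩
  suc (length (filter P? (zeros ++ minusOnes)))
    ≡⟨ cong (suc ∘ length) (filter-++ P? zeros _) ⟩
  suc (length (filter P? zeros ++ filter P? minusOnes))
    ≡⟨ cong suc (length-++ (filter P? zeros)) ⟩
  suc (length (filter P? zeros) + length (filter P? minusOnes))
    ≡⟨ cong₂ (λ u v → suc (length u + length v))
             (filter-all P? (replicate⁺ t ℚ.≤-refl))
             (filter-none P? (replicate⁺ m (λ 0≤-1 → ≤⇒≯ 0≤-1 -1<0))) ⟩
  suc (length zeros + 0) ≡⟨ cong suc (ℕ.+-identityʳ _) ⟩
  suc (length zeros)     ≡⟨ cong suc (length-replicate t) ⟩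
  suc t                  ∎
  where
  open ≡-Reasoning
  P? = 0ℚ ≤?_
  zeros = replicate t 0ℚ
  minusOnes = replicate m (- 1ℚ)

#nonneg-extremal : ∀ t m r → #nonneg 0ℚ 0 (extremal t m r) ≡ 2 ^ t * (binomialSum m r + 1)
#nonneg-extremal t m r = begin
  #nonneg (0ℚ +ℚ fromℕ r) 0 rest + #nonneg 0ℚ 0 rest
    ≡⟨ cong (λ c → #nonneg c 0 rest + #nonneg 0ℚ 0 rest) (ℚ.+-identityˡ (fromℕ r)) ⟩
  #nonneg (fromℕ r) 0 rest + #nonneg 0ℚ 0 rest
    ≡⟨ cong₂ _+_ (#nonneg-zeros++ t (fromℕ r) minusOnes) (#nonneg-zeros++ t 0ℚ minusOnes) ⟩
  2 ^ t * #nonneg (fromℕ r) 0 minusOnes + 2 ^ t * #nonneg 0ℚ 0 minusOnes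
    ≡⟨ cong₂ (λ u v → 2 ^ t * u + 2 ^ t * v) (#nonneg-minusOnes m r) (#nonneg-minusOnes m 0) ⟩
  2 ^ t * binomialSum m r + 2 ^ t * 1
    ≡⟨ ℕ.*-distribˡ-+ (2 ^ t) (binomialSum m r) 1 ⟨
  2 ^ t * (binomialSum m r + 1)
    ∎
  where
  open ≡-Reasoning
  minusOnes = replicate m (- 1ℚ)
  rest = replicate t 0ℚ ++ minusOnes

#nonneg-extremal-vanish : ∀ t m r → #nonneg 0ℚ (suc (suc t + r)) (extremal t m r) ≡ 0
#nonneg-extremal-vanish t m r = cong₂ _+_
  (trans (cong (λ c → #nonneg c (suc t + r) rest) (ℚ.+-identityˡ (fromℕ r)))
         (#nonneg-zeros++-vanish t (fromℕ r) minusOnes t+[1+r]≤1+t+r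
                                 (#nonneg-minusOnes-vanish m (ℕ.n<1+n r))))
  (#nonneg-zeros++-vanish t 0ℚ minusOnes (ℕ.m≤n⇒m≤1+n t+[1+r]≤1+t+r)
                          (#nonneg-minusOnes-vanish m {0} {suc r} (s≤s z≤n)))
  where
  minusOnes = replicate m (- 1ℚ)
  rest = replicate t 0ℚ ++ minusOnes
  t+[1+r]≤1+t+r : t + suc r ≤ suc t + r
  t+[1+r]≤1+t+r = ℕ.≤-reflexive (ℕ.+-suc t r)

-- From vectors and subsets to lists

length-filter-map : ∀ {A : Set a} {B : Set b} {P : Pred B p} (P? : Decidable P) (f : A → B) xs →
                    length (filter P? (map f xs)) ≡ length (filter (P? ∘ f) xs)
length-filter-map P? f []       = refl
length-filter-map P? f (x ∷ xs) with P? (f x)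
... | yes _ = cong suc (length-filter-map P? f xs)
... | no  _ = length-filter-map P? f xs

length-filter-nonneg-cong : ∀ {A : Set a} {f g : A → ℚ} → (∀ x → f x ≡ g x) → ∀ xs →
  length (filter (λ x → 0ℚ ≤? f x) xs) ≡ length (filter (λ x → 0ℚ ≤? g x) xs)
length-filter-nonneg-cong f≗g xs = cong length (filter-≐ _ _
  ((λ {x} → subst (0ℚ ≤ℚ_) (f≗g x)) , (λ {x} → subst (0ℚ ≤ℚ_) (sym (f≗g x)))) xs)

∣tabulate-does∣≡length-filter : ∀ {A : Set a} {P : Pred A p} (P? : Decidable P) {n}
  (x : Fin n → A) → ∣ Vec.tabulate (does ∘ P? ∘ x) ∣ ≡ length (filter P? (tabulate x))
∣tabulate-does∣≡length-filter P? {zero}  x = refl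
∣tabulate-does∣≡length-filter P? {suc n} x with P? (x zero)
... | yes _ = cong suc (∣tabulate-does∣≡length-filter P? (x ∘ suc))
... | no  _ = ∣tabulate-does∣≡length-filter P? (x ∘ suc)

#nonnegSubsets≡#nonneg : ∀ {n} (x : Fin n → ℚ) c →
  length (filter (λ U → 0ℚ ≤? c +ℚ subsetSum x U) (allSubsets n)) ≡ #nonneg c 0 (tabulate x)
#nonnegSubsets≡#nonneg {zero} x c = trans
  (length-filter-nonneg-cong {f = λ U → c +ℚ subsetSum x U} {g = λ _ → c}
                             (λ { [] → ℚ.+-identityʳ c }) (allSubsets 0))
  (single (0ℚ ≤? c))
  where
  single : Dec (0ℚ ≤ℚ c) → length (filter (λ _ → 0ℚ ≤? c) (allSubsets 0)) ≡ #nonneg c 0 []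
  single (yes 0≤c) =
    trans (cong length (filter-accept (λ _ → 0ℚ ≤? c) 0≤c)) (sym (#nonneg[]-nonneg 0≤c))
  single (no 0≰c)  =
    trans (cong length (filter-reject (λ _ → 0ℚ ≤? c) 0≰c)) (sym (#nonneg[]-neg 0 (ℚ.≰⇒> 0≰c)))
#nonnegSubsets≡#nonneg {suc n} x c = begin
  length (filter P? (map (true ∷_) Us ++ map (false ∷_) Us))
    ≡⟨ cong length (filter-++ P? (map (true ∷_) Us) _) ⟩
  length (filter P? (map (true ∷_) Us) ++ filter P? (map (false ∷_) Us))
    ≡⟨ length-++ (filter P? (map (true ∷_) Us)) ⟩
  length (filter P? (map (true ∷_) Us)) + length (filter P? (map (false ∷_) Us))
    ≡⟨ cong₂ _+_ (length-filter-map P? (true ∷_) Us) (length-filter-map P? (false ∷_) Us) ⟩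
  length (filter (P? ∘ (true ∷_)) Us) + length (filter (P? ∘ (false ∷_)) Us)
    ≡⟨ cong₂ _+_ (length-filter-nonneg-cong (λ U → sym (ℚ.+-assoc c (x zero) (Σ′ U))) Us)
                 (length-filter-nonneg-cong (λ U → cong (c +ℚ_) (ℚ.+-identityˡ (Σ′ U))) Us) ⟩
  length (filter (λ U → 0ℚ ≤? (c +ℚ x zero) +ℚ Σ′ U) Us)
    + length (filter (λ U → 0ℚ ≤? c +ℚ Σ′ U) Us)
    ≡⟨ cong₂ _+_ (#nonnegSubsets≡#nonneg (x ∘ suc) (c +ℚ x zero))
                 (#nonnegSubsets≡#nonneg (x ∘ suc) c) ⟩
  #nonneg c 0 (tabulate x) ∎
  where
  open ≡-Reasoning
  Us = allSubsets n
  P? = λ U → 0ℚ ≤? c +ℚ subsetSum x U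
  Σ′ = subsetSum (x ∘ suc)

numNonnegSubsets≡#nonneg : ∀ {n} (x : Fin n → ℚ) → numNonnegSubsets x ≡ #nonneg 0ℚ 0 (tabulate x)
numNonnegSubsets≡#nonneg {n} x =
  trans (length-filter-nonneg-cong (λ U → sym (ℚ.+-identityˡ (subsetSum x U))) (allSubsets n))
        (#nonnegSubsets≡#nonneg x 0ℚ)

negative⇒#nonneg≡0 : ∀ {n} (x : Fin n → ℚ) c j →
                     (∀ U → j ≤ ∣ U ∣ → c +ℚ subsetSum x U <ℚ 0ℚ) → #nonneg c j (tabulate x) ≡ 0
negative⇒#nonneg≡0 {zero}  x c zero    neg =
  #nonneg[]-neg 0 (subst (_<ℚ 0ℚ) (ℚ.+-identityʳ c) (neg [] z≤n))
negative⇒#nonneg≡0 {zero}  x c (suc j) neg = refl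
negative⇒#nonneg≡0 {suc n} x c j       neg = cong₂ _+_
  (negative⇒#nonneg≡0 (x ∘ suc) (c +ℚ x zero) (pred j) λ U j-1≤∣U∣ →
     subst (_<ℚ 0ℚ) (sym (ℚ.+-assoc c (x zero) _)) (neg (true ∷ U) (pred[m]≤n⇒m≤1+n j-1≤∣U∣)))
  (negative⇒#nonneg≡0 (x ∘ suc) c j λ U j≤∣U∣ →
     subst (_<ℚ 0ℚ) (cong (c +ℚ_) (ℚ.+-identityˡ _)) (neg (false ∷ U) j≤∣U∣))

#nonneg≡0⇒negative : ∀ {n} (x : Fin n → ℚ) c j → #nonneg c j (tabulate x) ≡ 0 →
                     ∀ U → j ≤ ∣ U ∣ → c +ℚ subsetSum x U <ℚ 0ℚ
#nonneg≡0⇒negative {zero}  x c zero none [] _ =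
  subst (_<ℚ 0ℚ) (sym (ℚ.+-identityʳ c)) (#nonneg[]≡0⇒neg none)
#nonneg≡0⇒negative {suc n} x c j none (true ∷ U) j≤1+∣U∣ =
  subst (_<ℚ 0ℚ) (ℚ.+-assoc c (x zero) _)
    (#nonneg≡0⇒negative (x ∘ suc) (c +ℚ x zero) (pred j) (ℕ.m+n≡0⇒m≡0 _ none)
                        U (ℕ.pred-mono-≤ j≤1+∣U∣))
#nonneg≡0⇒negative {suc n} x c j none (false ∷ U) j≤∣U∣ =
  subst (_<ℚ 0ℚ) (cong (c +ℚ_) (sym (ℚ.+-identityˡ _)))
    (#nonneg≡0⇒negative (x ∘ suc) c j (ℕ.m+n≡0⇒n≡0 _ none) U j≤∣U∣)

∃-tabulate≡ : ∀ {A : Set a} {n} (xs : List A) → length xs ≡ n →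
              Σ (Fin n → A) (λ x → tabulate x ≡ xs)
∃-tabulate≡ xs refl = lookup xs , tabulate-lookup xs

bound-suc : ∀ n k t → bound n k (suc t) ≡ 2 ^ t * (binomialSum (n ∸ suc t) (k ∸ suc t) + 1)
bound-suc n k t =
  cong (λ s → 2 ^ t * (s + 1)) (sum-binomials≡binomialSum (n ∸ suc t) (k ∸ suc t))

numNonnegSubsets≤bound : ∀ {n} k t (x : Fin n → ℚ) → suc t ≤ k → k < n →
  ∣ nonnegIndices x ∣ ≡ suc t → ((U : Subset n) → k < ∣ U ∣ → subsetSum x U <ℚ 0ℚ) →
  numNonnegSubsets x ≤ bound n k (suc t)
numNonnegSubsets≤bound {n} k t x t<k k<n #nonnegIndices≡1+t neg = begin
  numNonnegSubsets x                      ≡⟨ numNonnegSubsets≡#nonneg x ⟩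
  #nonneg 0ℚ 0 xs                         ≤⟨ #nonneg-upperBound t r xs #ps≡1+t r<n∸1+t none ⟩
  2 ^ t * (binomialSum (length xs ∸ suc t) r + 1)
    ≡⟨ cong (λ l → 2 ^ t * (binomialSum (l ∸ suc t) r + 1)) (length-tabulate x) ⟩
  2 ^ t * (binomialSum (n ∸ suc t) r + 1) ≡⟨ bound-suc n k t ⟨
  bound n k (suc t)                       ∎
  where
  open ℕ.≤-Reasoning
  xs = tabulate x
  r = k ∸ suc t
  #ps≡1+t : length (filter (0ℚ ≤?_) xs) ≡ suc t
  #ps≡1+t = trans (sym (∣tabulate-does∣≡length-filter (0ℚ ≤?_) x)) #nonnegIndices≡1+t
  r<n∸1+t : r < length xs ∸ suc t
  r<n∸1+t = subst (λ l → r < l ∸ suc t) (sym (length-tabulate x)) (ℕ.∸-monoˡ-< k<n t<k)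
  none : #nonneg 0ℚ (suc (suc t + r)) xs ≡ 0
  none = subst (λ j → #nonneg 0ℚ (suc j) xs ≡ 0) (sym (ℕ.m+[n∸m]≡n t<k))
    (negative⇒#nonneg≡0 x 0ℚ (suc k) λ U k<∣U∣ →
       subst (_<ℚ 0ℚ) (sym (ℚ.+-identityˡ _)) (neg U k<∣U∣))

bound-attained : ∀ n k t → suc t ≤ k → k < n →
  Σ (Fin n → ℚ) (λ x → ∣ nonnegIndices x ∣ ≡ suc t ×
    ((U : Subset n) → k < ∣ U ∣ → subsetSum x U <ℚ 0ℚ) ×
    numNonnegSubsets x ≡ bound n k (suc t))
bound-attained n k t t<k k<n = x , #nonnegIndices≡1+t , negative , count
  where
  open ≡-Reasoning
  m = n ∸ suc t
  r = k ∸ suc t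
  xs = extremal t m r
  realised : Σ (Fin n → ℚ) (λ x → tabulate x ≡ xs)
  realised = ∃-tabulate≡ xs
    (trans (length-extremal t m r) (ℕ.m+[n∸m]≡n (ℕ.≤-trans t<k (ℕ.<⇒≤ k<n))))
  x = proj₁ realised
  x≡xs = proj₂ realised
  #nonnegIndices≡1+t : ∣ nonnegIndices x ∣ ≡ suc t
  #nonnegIndices≡1+t = begin
    ∣ nonnegIndices x ∣                   ≡⟨ ∣tabulate-does∣≡length-filter (0ℚ ≤?_) x ⟩
    length (filter (0ℚ ≤?_) (tabulate x)) ≡⟨ cong (length ∘ filter (0ℚ ≤?_)) x≡xs ⟩
    length (filter (0ℚ ≤?_) xs)           ≡⟨ #nonnegEntries-extremal t m r ⟩
    suc t                                 ∎
  none : #nonneg 0ℚ (suc k) (tabulate x) ≡ 0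
  none = trans (cong (#nonneg 0ℚ (suc k)) x≡xs)
    (subst (λ j → #nonneg 0ℚ (suc j) xs ≡ 0) (ℕ.m+[n∸m]≡n t<k) (#nonneg-extremal-vanish t m r))
  negative : (U : Subset n) → k < ∣ U ∣ → subsetSum x U <ℚ 0ℚ
  negative U k<∣U∣ =
    subst (_<ℚ 0ℚ) (ℚ.+-identityˡ _) (#nonneg≡0⇒negative x 0ℚ (suc k) none U k<∣U∣)
  count : numNonnegSubsets x ≡ bound n k (suc t)
  count = begin
    numNonnegSubsets x            ≡⟨ numNonnegSubsets≡#nonneg x ⟩
    #nonneg 0ℚ 0 (tabulate x)     ≡⟨ cong (#nonneg 0ℚ 0) x≡xs ⟩
    #nonneg 0ℚ 0 xs               ≡⟨ #nonneg-extremal t m r ⟩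
    2 ^ t * (binomialSum m r + 1) ≡⟨ bound-suc n k t ⟨
    bound n k (suc t)             ∎

theorem1p2 : (n k t : ℕ) → 1 ≤ t → t ≤ k → k < n →
    ((x : Fin n → ℚ) → ∣ nonnegIndices x ∣ ≡ t →
      ((U : Subset n) → k < ∣ U ∣ → subsetSum x U <ℚ 0ℚ) →
      numNonnegSubsets x ≤ bound n k t)
    × Σ (Fin n → ℚ) (λ x → ∣ nonnegIndices x ∣ ≡ t ×
      ((U : Subset n) → k < ∣ U ∣ → subsetSum x U <ℚ 0ℚ) ×
      numNonnegSubsets x ≡ bound n k t)
theorem1p2 n k (suc t) (s≤s z≤n) t<k k<n =
  (λ x → numNonnegSubsets≤bound k t x t<k k<n) , bound-attained n k t t<k k<n
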